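{- Let $W=\{(0^m),(1^m)\}$ be the repetition code in $H(m,2)$ (vertex set $\mathbb{F}_2^m$), and let $C$ be an $(X,2)$-neighbour-transitive extension of $W$ with minimum distance $\delta\geq 5$. Then $X_{\mathbf{0}}\cong X_{\mathbf{0}}^M=X_W^M$, $K=T_W$, and $X_W=T_W\rtimes X_{\mathbf{0}}$.
   Context: The Hamming graph $H(m,q)$ has vertex set $Q^m$ (entry set $M$), vertices adjacent iff they differ in exactly one entry. For a code $D$, $D_s$ is the set of vertices at distance exactly $s$ from $D$. $\mathrm{Aut}(H(m,q))=B\rtimes L$ with $B\cong\mathrm{Sym}(Q)^m$ acting coordinatewise and $L\cong\mathrm{Sym}(M)$ permuting entries; $\mathrm{Aut}(C)$ is the setwise stabiliser of $C$. For $X\leq\mathrm{Aut}(C)$, $C$ is $(X,2)$-neighbour-transitive if $X$ is transitive on each of $C$, $C_1$, $C_2$. $K=X\cap B$; $T_W=\{\alpha\mapsto\alpha+w:w\in W\}$; $K_W$ is the setwise stabiliser of $W$ in $K$. An $(X,2)$-neighbour-transitive extension of $W$ is an $(X,2)$-neighbour-transitive code $C$ with $\mathbf{0}\in C$, $T_W\leq X$ and $K=K_W$. $X_{\mathbf{0}}$ and $X_W$ are the stabilisers in $X$ of the vertex $\mathbf{0}$ and of the set $W$; for $Y\leq X$, $Y^M$ denotes the permutation group induced by $Y$ on $M$. -}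

module Defs where

open import Data.Nat using (ℕ; zero; suc; _+_; _≤_)
open import Data.Bool using (Bool; true; false; _xor_)
open import Data.Fin using (Fin)
open import Data.Vec using (Vec; []; _∷_; lookup; tabulate; replicate)
open import Data.Fin.Permutation using (Permutation′; _⟨$⟩ʳ_; _⟨$⟩ˡ_)
open import Data.Product using (Σ; ∃; _×_; _,_)
open import Data.Sum using (_⊎_)
open import Relation.Binary.PropositionalEquality using (_≡_; _≢_)
open import Function.Bundles using (_⇔_)

-- Vertices of the Hamming graph H(m,2): words of length m over Q = F₂ = Bool;
-- the entry set is M = Fin m.
Vertex : ℕ → Set
Vertex m = Vec Bool m

dist : ∀ {m} → Vertex m → Vertex m → ℕ
dist []       []       = 0
dist (x ∷ xs) (y ∷ ys) = (if x xor y then 1 else 0) + dist xs ys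
  where open import Data.Bool using (if_then_else_)

_⊕_ : ∀ {m} → Vertex m → Vertex m → Vertex m
_⊕_ {m} α β = tabulate λ i → lookup α i xor lookup β i

Code : ℕ → Set₁
Code m = Vertex m → Set

-- Aut(H(m,2)) = B ⋊ L.  Since Sym(F₂) ≅ F₂ (acting by translation), an element of
-- B ≅ Sym(F₂)^m is a vector b ∈ F₂^m, and an element of L ≅ Sym(M) is a permutation π
-- of the entries.  The element (b , π) maps α to the vertex whose entry π(j) is
-- α_j + b_{π(j)}.
record Aut (m : ℕ) : Set where
  constructor aut
  field
    shift : Vertex m
    perm  : Permutation′ m
open Aut public

act : ∀ {m} → Aut m → Vertex m → Vertex m
act g α = tabulate λ i → lookup (shift g) i xor lookup α (perm g ⟨$⟩ˡ i)

_≈_ : ∀ {m} → Aut m → Aut m → Set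
g ≈ h = ∀ α → act g α ≡ act h α

_≈ᴹ_ : ∀ {m} → Aut m → Aut m → Set
g ≈ᴹ h = ∀ i → perm g ⟨$⟩ʳ i ≡ perm h ⟨$⟩ʳ i

InB : ∀ {m} → Aut m → Set
InB g = ∀ i → perm g ⟨$⟩ʳ i ≡ i

translation : ∀ {m} → Vertex m → Aut m
translation {m} w = aut w Data.Fin.Permutation.id
  where import Data.Fin.Permutation

record Subgroup (m : ℕ) : Set₁ where
  field
    _∈X      : Aut m → Set
    respects : ∀ {g h} → g ≈ h → g ∈X → h ∈X
    has-id   : ∃ λ e → e ∈X × (∀ α → act e α ≡ α)
    closed-∘ : ∀ {g h} → g ∈X → h ∈X → ∃ λ k → k ∈X × (∀ α → act k α ≡ act g (act h α))
    closed-⁻¹ : ∀ {g} → g ∈X → ∃ λ k → k ∈X × (∀ α → act k (act g α) ≡ α)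
open Subgroup public

Stabilises : ∀ {m} → Code m → Aut m → Set
Stabilises S g = ∀ α → S α ⇔ S (act g α)

_≤Aut_ : ∀ {m} → Subgroup m → Code m → Set
X ≤Aut C = ∀ g → _∈X X g → Stabilises C g

Dist= : ∀ {m} → Code m → ℕ → Code m
Dist= D s α = (∃ λ β → D β × dist α β ≡ s) × (∀ β → D β → s ≤ dist α β)

Transitive : ∀ {m} → Subgroup m → Code m → Set
Transitive X S = ∀ α β → S α → S β → ∃ λ g → _∈X X g × act g α ≡ β

NeighbourTransitive2 : ∀ {m} → Subgroup m → Code m → Set
NeighbourTransitive2 X C =
  X ≤Aut C × Transitive X C × Transitive X (Dist= C 1) × Transitive X (Dist= C 2)

MinDistAtLeast : ∀ {m} → Code m → ℕ → Set
MinDistAtLeast C d = ∀ α β → C α → C β → α ≢ β → d ≤ dist α β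

zero-vec : ∀ m → Vertex m
zero-vec m = replicate m false

Rep : ∀ m → Code m
Rep m α = (α ≡ replicate m false) ⊎ (α ≡ replicate m true)

T≤ : ∀ {m} → Code m → Subgroup m → Set
T≤ W X = ∀ w → W w → _∈X X (translation w)

-- K = X ∩ B equals K_W (every element of K stabilises W).
K≡K_W : ∀ {m} → Code m → Subgroup m → Set
K≡K_W W X = ∀ g → _∈X X g → InB g → Stabilises W g

Extension : ∀ {m} → Subgroup m → Code m → Code m → Set
Extension {m} X W C =
  NeighbourTransitive2 X C × C (zero-vec m) × T≤ W X × K≡K_W W X

In-X₀ : ∀ {m} → Subgroup m → Aut m → Set
In-X₀ {m} X g = _∈X X g × act g (zero-vec m) ≡ zero-vec m

In-X_W : ∀ {m} → Subgroup m → Code m → Aut m → Set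
In-X_W X W g = _∈X X g × Stabilises W g

module Submission where

-- Over F₂ we have Sym(F₂) ≅ F₂, so the base group B consists exactly of the
-- translations α ↦ α + b, and every automorphism g = (b, π) factors as
-- g = t_b ∘ ℓ(g), where ℓ(g) = (0, π) is its "entry-permutation part".  Two
-- facts about the F₂-vector space F₂^m drive everything:
--   * entry permutations fix the constant vectors, so automorphisms commute
--     with translations by elements of W;
--   * g stabilises W if and only if its translation part b = g(0) lies in W.
-- From these: K = X ∩ B ⊆ T_W because K stabilises W; for g ∈ X_W the
-- element ℓ(g) = t_b ∘ g lies in X (as t_b ∈ T_W ≤ X) and fixes 0, which gives
-- X_W = T_W X₀ and X_W^M = X₀^M; and an element of X₀ has zero translation
-- part, so it is determined by its action on M.

open import Defs
open import Data.Nat using (ℕ)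
open import Data.Bool using (Bool; true; false; _xor_)
open import Data.Bool.Properties using (xor-assoc; xor-comm; xor-same)
open import Data.Fin using (Fin)
open import Data.Vec using (lookup; replicate)
open import Data.Vec.Properties using (lookup∘tabulate; tabulate∘lookup; tabulate-cong; lookup-replicate)
open import Data.Fin.Permutation using (_⟨$⟩ʳ_; _⟨$⟩ˡ_; inverseˡ; inverseʳ)
open import Data.Product using (∃; _×_; _,_; proj₁; proj₂)
open import Data.Sum using (inj₁; inj₂)
open import Function.Bundles using (mk⇔; Equivalence)
open import Relation.Binary.PropositionalEquality

private
  variable
    m : ℕ

vec-ext : {u v : Vertex m} → (∀ i → lookup u i ≡ lookup v i) → u ≡ v
vec-ext {u = u} {v} p = trans (sym (tabulate∘lookup u)) (trans (tabulate-cong p) (tabulate∘lookup v))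

lookup-⊕ : (u v : Vertex m) (i : Fin m) → lookup (u ⊕ v) i ≡ lookup u i xor lookup v i
lookup-⊕ u v i = lookup∘tabulate _ i

⊕-cancelˡ : (u v : Vertex m) → u ⊕ (u ⊕ v) ≡ v
⊕-cancelˡ u v = vec-ext λ i → begin
  lookup (u ⊕ (u ⊕ v)) i                    ≡⟨ lookup-⊕ u (u ⊕ v) i ⟩
  lookup u i xor lookup (u ⊕ v) i           ≡⟨ cong (lookup u i xor_) (lookup-⊕ u v i) ⟩
  lookup u i xor (lookup u i xor lookup v i) ≡⟨ sym (xor-assoc (lookup u i) _ _) ⟩
  (lookup u i xor lookup u i) xor lookup v i ≡⟨ cong (_xor lookup v i) (xor-same (lookup u i)) ⟩
  lookup v i                                ∎
  where open ≡-Reasoning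

replicate-⊕ : (b c : Bool) → replicate m b ⊕ replicate m c ≡ replicate m (b xor c)
replicate-⊕ {m} b c = vec-ext λ i → begin
  lookup (replicate m b ⊕ replicate m c) i                 ≡⟨ lookup-⊕ (replicate m b) (replicate m c) i ⟩
  lookup (replicate m b) i xor lookup (replicate m c) i    ≡⟨ cong₂ _xor_ (lookup-replicate i b) (lookup-replicate i c) ⟩
  b xor c                                                  ≡⟨ sym (lookup-replicate i (b xor c)) ⟩
  lookup (replicate m (b xor c)) i                         ∎
  where open ≡-Reasoning

Rep-replicate : (b : Bool) → Rep m (replicate m b)
Rep-replicate false = inj₁ refl
Rep-replicate true  = inj₂ refl

Rep⇒replicate : {α : Vertex m} → Rep m α → ∃ λ b → α ≡ replicate m b
Rep⇒replicate (inj₁ e) = false , e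
Rep⇒replicate (inj₂ e) = true , e

Rep-⊕ : {u v : Vertex m} → Rep m u → Rep m v → Rep m (u ⊕ v)
Rep-⊕ {m} ru rv with Rep⇒replicate ru | Rep⇒replicate rv
... | b , refl | c , refl = subst (Rep m) (sym (replicate-⊕ b c)) (Rep-replicate (b xor c))

lookup-act : (g : Aut m) (α : Vertex m) (i : Fin m) →
  lookup (act g α) i ≡ lookup (shift g) i xor lookup α (perm g ⟨$⟩ˡ i)
lookup-act g α i = lookup∘tabulate _ i

act-translation : (w α : Vertex m) → act (translation w) α ≡ w ⊕ α
act-translation w α = refl

act-zero : (g : Aut m) → act g (zero-vec m) ≡ shift g
act-zero {m} g = vec-ext λ i → begin
  lookup (act g (zero-vec m)) i                                   ≡⟨ lookup-act g (zero-vec m) i ⟩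
  lookup (shift g) i xor lookup (zero-vec m) (perm g ⟨$⟩ˡ i)      ≡⟨ cong (lookup (shift g) i xor_) (lookup-replicate (perm g ⟨$⟩ˡ i) false) ⟩
  lookup (shift g) i xor false                                     ≡⟨ xor-comm (lookup (shift g) i) false ⟩
  lookup (shift g) i                                               ∎
  where open ≡-Reasoning

act-injective : (g : Aut m) {α β : Vertex m} → act g α ≡ act g β → α ≡ β
act-injective g {α} {β} e = vec-ext λ j → begin
  lookup α j                              ≡⟨ cong (lookup α) (sym (inverseˡ (perm g))) ⟩
  lookup α (πˡ (πʳ j))                    ≡⟨ sym (⊕-entry α j) ⟩
  s j xor (s j xor lookup α (πˡ (πʳ j)))  ≡⟨ cong (s j xor_) (entry-eq j) ⟩
  s j xor (s j xor lookup β (πˡ (πʳ j)))  ≡⟨ ⊕-entry β j ⟩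
  lookup β (πˡ (πʳ j))                    ≡⟨ cong (lookup β) (inverseˡ (perm g)) ⟩
  lookup β j                              ∎
  where
  open ≡-Reasoning
  πʳ πˡ : Fin _ → Fin _
  πʳ = perm g ⟨$⟩ʳ_
  πˡ = perm g ⟨$⟩ˡ_
  s : Fin _ → Bool
  s j = lookup (shift g) (πʳ j)
  ⊕-entry : ∀ γ j → s j xor (s j xor lookup γ (πˡ (πʳ j))) ≡ lookup γ (πˡ (πʳ j))
  ⊕-entry γ j = trans (sym (xor-assoc (s j) (s j) (lookup γ (πˡ (πʳ j))))) (cong (_xor lookup γ (πˡ (πʳ j))) (xor-same (s j)))
  entry-eq : ∀ j → s j xor lookup α (πˡ (πʳ j)) ≡ s j xor lookup β (πˡ (πʳ j))
  entry-eq j = trans (sym (lookup-act g α (πʳ j))) (trans (cong (λ v → lookup v (πʳ j)) e) (lookup-act g β (πʳ j)))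

lPart : Aut m → Aut m
lPart {m} g = aut (zero-vec m) (perm g)

lookup-lPart : (g : Aut m) (α : Vertex m) (i : Fin m) → lookup (act (lPart g) α) i ≡ lookup α (perm g ⟨$⟩ˡ i)
lookup-lPart g α i = trans (lookup-act (lPart g) α i) (cong (_xor lookup α (perm g ⟨$⟩ˡ i)) (lookup-replicate i false))

act-decompose : (g : Aut m) (α : Vertex m) → act g α ≡ shift g ⊕ act (lPart g) α
act-decompose g α = vec-ext λ i → begin
  lookup (act g α) i                                     ≡⟨ lookup-act g α i ⟩
  lookup (shift g) i xor lookup α (perm g ⟨$⟩ˡ i)        ≡⟨ cong (lookup (shift g) i xor_) (sym (lookup-lPart g α i)) ⟩
  lookup (shift g) i xor lookup (act (lPart g) α) i      ≡⟨ sym (lookup-⊕ (shift g) (act (lPart g) α) i) ⟩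
  lookup (shift g ⊕ act (lPart g) α) i                   ∎
  where open ≡-Reasoning

same-parts⇒≈ : (g h : Aut m) → shift g ≡ shift h → g ≈ᴹ h → g ≈ h
same-parts⇒≈ g h s≡ π≡ α = begin
  act g α                    ≡⟨ act-decompose g α ⟩
  shift g ⊕ act (lPart g) α  ≡⟨ cong₂ _⊕_ s≡ (vec-ext {u = act (lPart g) α} {act (lPart h) α} ℓ-agree) ⟩
  shift h ⊕ act (lPart h) α  ≡⟨ sym (act-decompose h α) ⟩
  act h α                    ∎
  where
  open ≡-Reasoning
  ˡ-agree : ∀ i → perm g ⟨$⟩ˡ i ≡ perm h ⟨$⟩ˡ i
  ˡ-agree i = trans (sym (inverseˡ (perm h))) (cong (perm h ⟨$⟩ˡ_) (trans (sym (π≡ _)) (inverseʳ (perm g))))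
  ℓ-agree : ∀ i → lookup (act (lPart g) α) i ≡ lookup (act (lPart h) α) i
  ℓ-agree i = trans (lookup-lPart g α i) (trans (cong (lookup α) (ˡ-agree i)) (sym (lookup-lPart h α i)))

InB⇒translation : (g : Aut m) → InB g → g ≈ translation (shift g)
InB⇒translation g inB = same-parts⇒≈ g (translation (shift g)) refl inB

lPart-⊕ : (g : Aut m) (u v : Vertex m) → act (lPart g) (u ⊕ v) ≡ act (lPart g) u ⊕ act (lPart g) v
lPart-⊕ g u v = vec-ext λ i → begin
  lookup (act (lPart g) (u ⊕ v)) i                                ≡⟨ lookup-lPart g (u ⊕ v) i ⟩
  lookup (u ⊕ v) (perm g ⟨$⟩ˡ i)                                  ≡⟨ lookup-⊕ u v (perm g ⟨$⟩ˡ i) ⟩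
  lookup u (perm g ⟨$⟩ˡ i) xor lookup v (perm g ⟨$⟩ˡ i)           ≡⟨ sym (cong₂ _xor_ (lookup-lPart g u i) (lookup-lPart g v i)) ⟩
  lookup (act (lPart g) u) i xor lookup (act (lPart g) v) i       ≡⟨ sym (lookup-⊕ (act (lPart g) u) (act (lPart g) v) i) ⟩
  lookup (act (lPart g) u ⊕ act (lPart g) v) i                    ∎
  where open ≡-Reasoning

lPart-Rep : (g : Aut m) {w : Vertex m} → Rep m w → act (lPart g) w ≡ w
lPart-Rep {m} g rw with Rep⇒replicate rw
... | b , refl = vec-ext λ i →
  trans (lookup-lPart g (replicate m b) i)
        (trans (lookup-replicate (perm g ⟨$⟩ˡ i) b) (sym (lookup-replicate i b)))

act-Rep : (g : Aut m) {α : Vertex m} → Rep m α → act g α ≡ shift g ⊕ α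
act-Rep g {α} rα = trans (act-decompose g α) (cong (shift g ⊕_) (lPart-Rep g rα))

⊕-swapˡ : (u v w : Vertex m) → u ⊕ (v ⊕ w) ≡ v ⊕ (u ⊕ w)
⊕-swapˡ u v w = vec-ext λ i →
  trans (entries u v i) (trans (xor-swapˡ (lookup u i) (lookup v i) (lookup w i)) (sym (entries v u i)))
  where
  entries : ∀ x y i → lookup (x ⊕ (y ⊕ w)) i ≡ lookup x i xor (lookup y i xor lookup w i)
  entries x y i = trans (lookup-⊕ x (y ⊕ w) i) (cong (lookup x i xor_) (lookup-⊕ y w i))
  xor-swapˡ : ∀ a b c → a xor (b xor c) ≡ b xor (a xor c)
  xor-swapˡ a b c = begin
    a xor (b xor c)  ≡⟨ sym (xor-assoc a b c) ⟩
    (a xor b) xor c  ≡⟨ cong (_xor c) (xor-comm a b) ⟩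
    (b xor a) xor c  ≡⟨ xor-assoc b a c ⟩
    b xor (a xor c)  ∎
    where open ≡-Reasoning

act-commutes-T_W : (g : Aut m) {w : Vertex m} → Rep m w → (α : Vertex m) →
  act g (act (translation w) α) ≡ act (translation w) (act g α)
act-commutes-T_W g {w} rw α = begin
  act g (w ⊕ α)                                 ≡⟨ act-decompose g (w ⊕ α) ⟩
  shift g ⊕ act (lPart g) (w ⊕ α)               ≡⟨ cong (shift g ⊕_) (lPart-⊕ g w α) ⟩
  shift g ⊕ (act (lPart g) w ⊕ act (lPart g) α) ≡⟨ cong (λ v → shift g ⊕ (v ⊕ act (lPart g) α)) (lPart-Rep g rw) ⟩
  shift g ⊕ (w ⊕ act (lPart g) α)               ≡⟨ ⊕-swapˡ (shift g) w (act (lPart g) α) ⟩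
  w ⊕ (shift g ⊕ act (lPart g) α)               ≡⟨ cong (w ⊕_) (sym (act-decompose g α)) ⟩
  w ⊕ act g α                                   ∎
  where open ≡-Reasoning

Stabilises-Rep⇒shift : (g : Aut m) → Stabilises (Rep m) g → Rep m (shift g)
Stabilises-Rep⇒shift {m} g st = subst (Rep m) (act-zero g) (Equivalence.to (st (zero-vec m)) (inj₁ refl))

shift⇒Stabilises-Rep : (g : Aut m) → Rep m (shift g) → Stabilises (Rep m) g
shift⇒Stabilises-Rep {m} g rs α = mk⇔ image preimage
  where
  image : Rep m α → Rep m (act g α)
  image rα = subst (Rep m) (sym (act-Rep g rα)) (Rep-⊕ rs rα)
  -- The candidate preimage b + g(α) ∈ W is mapped to g(α), hence equals α.
  preimage : Rep m (act g α) → Rep m α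
  preimage rgα = subst (Rep m) (act-injective g maps-to-gα) (Rep-⊕ rs rgα)
    where
    maps-to-gα : act g (shift g ⊕ act g α) ≡ act g α
    maps-to-gα = trans (act-Rep g (Rep-⊕ rs rgα)) (⊕-cancelˡ (shift g) (act g α))

X₀-shift : (X : Subgroup m) {g : Aut m} → In-X₀ X g → shift g ≡ zero-vec m
X₀-shift X {g} (_ , g0≡0) = trans (sym (act-zero g)) g0≡0

-- X₀ ≤ X_W, since the translation part 0 lies in W.
X₀≤X_W : (X : Subgroup m) {g : Aut m} → In-X₀ X g → In-X_W X (Rep m) g
X₀≤X_W X {g} x₀ = proj₁ x₀ , shift⇒Stabilises-Rep g (inj₁ (X₀-shift X x₀))

-- If T_W ≤ X then for g ∈ X_W the element ℓ(g) = t_b ∘ g (b = g(0) ∈ W) lies in X₀.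
lPart-∈X₀ : (X : Subgroup m) → T≤ (Rep m) X → {g : Aut m} → In-X_W X (Rep m) g → In-X₀ X (lPart g)
lPart-∈X₀ X T_W≤X {g} (g∈X , g-stab) with closed-∘ X (T_W≤X (shift g) (Stabilises-Rep⇒shift g g-stab)) g∈X
... | k , k∈X , k-act = respects X k≈ℓ k∈X , act-zero (lPart g)
  where
  open ≡-Reasoning
  k≈ℓ : k ≈ lPart g
  k≈ℓ α = begin
    act k α                                ≡⟨ trans (k-act α) (act-translation (shift g) (act g α)) ⟩
    shift g ⊕ act g α                      ≡⟨ cong (shift g ⊕_) (act-decompose g α) ⟩
    shift g ⊕ (shift g ⊕ act (lPart g) α)  ≡⟨ ⊕-cancelˡ (shift g) (act (lPart g) α) ⟩
    act (lPart g) α                        ∎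

lemma3p4 : (m : ℕ) (X : Subgroup m) (C : Code m) →
  Extension X (Rep m) C → MinDistAtLeast C 5 →
  -- X₀ ≅ X₀^M : the restriction map X₀ → X₀^M is injective
  (∀ g h → In-X₀ X g → In-X₀ X h → g ≈ᴹ h → g ≈ h)
  -- X₀^M ⊆ X_W^M
  × (∀ g → In-X₀ X g → ∃ λ h → In-X_W X (Rep m) h × h ≈ᴹ g)
  -- X_W^M ⊆ X₀^M
  × (∀ g → In-X_W X (Rep m) g → ∃ λ h → In-X₀ X h × h ≈ᴹ g)
  -- K = T_W : K ⊆ T_W
  × (∀ g → _∈X X g → InB g → ∃ λ w → Rep m w × g ≈ translation w)
  -- T_W ⊆ K
  × (∀ w → Rep m w → _∈X X (translation w) × InB (translation w))
  -- X_W = T_W ⋊ X₀ : T_W ≤ X_W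
  × (∀ w → Rep m w → In-X_W X (Rep m) (translation w))
  -- X₀ ≤ X_W
  × (∀ g → In-X₀ X g → In-X_W X (Rep m) g)
  -- T_W ⊴ X_W
  × (∀ g w → In-X_W X (Rep m) g → Rep m w → ∃ λ w′ → Rep m w′
       × (∀ α → act g (act (translation w) α) ≡ act (translation w′) (act g α)))
  -- T_W ∩ X₀ = 1
  × (∀ w → Rep m w → In-X₀ X (translation w) → w ≡ zero-vec m)
  -- X_W = T_W X₀
  × (∀ g → In-X_W X (Rep m) g → ∃ λ w → ∃ λ h → Rep m w × In-X₀ X h
       × (∀ α → act g α ≡ act (translation w) (act h α)))
lemma3p4 m X C (_ , _ , T_W≤X , K≤K_W) _ =
  X₀-faithful , (λ g x₀ → g , X₀≤X_W X x₀ , λ _ → refl) , (λ g xw → lPart g , lPart-∈X₀ X T_W≤X xw , λ _ → refl)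
  , K⊆T_W , (λ w rw → T_W≤X w rw , λ _ → refl) , (λ w rw → T_W≤X w rw , shift⇒Stabilises-Rep (translation w) rw)
  , (λ g → X₀≤X_W X) , (λ g w _ rw → w , rw , act-commutes-T_W g rw) , (λ w _ x₀ → X₀-shift X x₀)
  , X_W=T_W·X₀
  where
  -- X₀ acts faithfully on M: its elements all have translation part 0.
  X₀-faithful : ∀ g h → In-X₀ X g → In-X₀ X h → g ≈ᴹ h → g ≈ h
  X₀-faithful g h x₀g x₀h = same-parts⇒≈ g h (trans (X₀-shift X x₀g) (sym (X₀-shift X x₀h)))
  -- K ⊆ T_W: an element of K is a translation and stabilises W.
  K⊆T_W : ∀ g → _∈X X g → InB g → ∃ λ w → Rep m w × g ≈ translation w
  K⊆T_W g g∈X inB = shift g , Stabilises-Rep⇒shift g (K≤K_W g g∈X inB) , InB⇒translation g inB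
  -- g = t_b ∘ ℓ(g) with t_b ∈ T_W and ℓ(g) ∈ X₀.
  X_W=T_W·X₀ : ∀ g → In-X_W X (Rep m) g → ∃ λ w → ∃ λ h → Rep m w × In-X₀ X h
    × (∀ α → act g α ≡ act (translation w) (act h α))
  X_W=T_W·X₀ g xw = shift g , lPart g , Stabilises-Rep⇒shift g (proj₂ xw) , lPart-∈X₀ X T_W≤X xw , act-decompose g
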